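{- For all $v\in\{a,b\}^*$, $h(v)=H(\langle bvb\rangle)$.
   Context: A word is constant if it is a power of one letter (including $\varepsilon$). For non-constant $u$, ${}_+u$ is the longest suffix of $u$ immediately preceded by the letter different from the first letter of $u$. Height: $v_{(1)}=v$, $v_{(n+1)}={}_+(v_{(n)})$ while $v_{(n)}$ is non-constant; $h(v)$ is the index $h$ such that $v_{(h)}$ is constant. $\langle w\rangle$ is the integer whose base-2 expansion is $w$ with $a$ read as digit $0$ and $b$ as digit $1$. $H:\mathbb N_{>0}\to\mathbb N$ is defined by $H(1)=0$, $H(2n)=H(n)$, $H(4n\pm1)=H(n)+1$ for $n>0$. -}

module Defs where

open import Data.Nat using (ℕ; zero; suc; _+_; _*_; _∸_)
open import Data.List using (List; []; _∷_; foldl)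
open import Data.List.Relation.Unary.All using (All)
open import Data.Product using (Σ)
open import Relation.Binary.PropositionalEquality using (_≡_)
open import Relation.Nullary using (¬_)

data Letter : Set where
  a b : Letter

Word : Set
Word = List Letter

Constant : Word → Set
Constant w = Σ Letter λ x → All (_≡ x) w

-- ₊u : for u = x u', the longest suffix of u immediately preceded by the
-- letter different from x, i.e. the part of u after the first occurrence
-- of the other letter.  (Value on constant words is irrelevant: ₊ is only
-- used on non-constant words below.)
plusAfter : Letter → Word → Word
plusAfter _ [] = []
plusAfter a (a ∷ r) = plusAfter a r
plusAfter a (b ∷ r) = r
plusAfter b (b ∷ r) = plusAfter b r
plusAfter b (a ∷ r) = r

₊_ : Word → Word
₊ [] = []
₊ (x ∷ r) = plusAfter x r

-- Height : Height v h  means  h(v) = h, following the paper's definition: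
-- v₍₁₎ = v, v₍ₙ₊₁₎ = ₊ v₍ₙ₎ while v₍ₙ₎ is non-constant, and h(v) is the
-- index h with v₍ₕ₎ constant.
data Height : Word → ℕ → Set where
  const : ∀ {v} → Constant v → Height v 1
  step  : ∀ {v n} → ¬ Constant v → Height (₊ v) n → Height v (suc n)

digit : Letter → ℕ
digit a = 0
digit b = 1

⟨_⟩ : Word → ℕ
⟨ w ⟩ = foldl (λ acc c → 2 * acc + digit c) 0 w

-- H : ℕ>0 → ℕ as the graph of its defining equations:
-- H(1) = 0, H(2n) = H(n), H(4n+1) = H(n)+1, H(4n-1) = H(n)+1  (n > 0).
data HVal : ℕ → ℕ → Set where
  H1  : HVal 1 0
  H2n : ∀ {n k} → HVal (suc n) k → HVal (2 * suc n) k
  H4p : ∀ {n k} → HVal (suc n) k → HVal (4 * suc n + 1) (suc k)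
  H4m : ∀ {n k} → HVal (suc n) k → HVal (4 * suc n ∸ 1) (suc k)

-- Write v = x^(i+1) x̄ r with x̄ the letter other than x, so that ₊v = r and
-- h(v) = h(r) + 1; a constant v has h(v) = 1 = H(⟨bvb⟩) by direct computation.
-- With P = ⟨b x^(i+1) x̄⟩ and s = r b we have ⟨bvb⟩ = P·2^|s| + ⟨s⟩ and
-- ⟨brb⟩ = 1·2^|s| + ⟨s⟩, so it suffices that replacing the leading 1 by P
-- raises H by one.  The recursion of H reads the binary expansion from the
-- right, one digit (2m) or two digits (4m ± 1) at a time, so this propagates
-- by induction on j to every suffix value T ≤ 2^j (T = 2^j is reached through
-- the carry in 4m − 1 ↦ m), starting from (j, T) ∈ {(0, 0), (0, 1), (1, 1)}.
-- Those base cases say H(P) = 1, H(P + 1) = 1 and H(2P + 1) = 2, which are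
-- computed for both letters x.
module Submission where

open import Defs
open import Data.Empty using (⊥-elim)
open import Data.List using ([]; _∷_; _++_; length; replicate; foldl)
open import Data.List.Properties using (foldl-++; ++-assoc)
open import Data.List.Relation.Unary.All using ([]; _∷_)
open import Data.List.Relation.Unary.All.Properties using (replicate⁺; ++⁻ʳ)
open import Data.Nat using (ℕ; zero; suc; _+_; _*_; _∸_; _^_; _≤_; _<_; s≤s; z≤n)
open import Data.Nat.Properties
open import Data.Nat.Tactic.RingSolver using (solve-∀)
open import Data.Product using (Σ; ∃-syntax; _×_; _,_; proj₁)
open import Relation.Binary.PropositionalEquality
open import Relation.Nullary using (¬_; contradiction)

-- Residues modulo 4

4n+1≡1+2[2n] : ∀ n → 4 * n + 1 ≡ suc (2 * (2 * n))
4n+1≡1+2[2n] = solve-∀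

4n+3≡1+2[1+2n] : ∀ n → 4 * n + 3 ≡ suc (2 * suc (2 * n))
4n+3≡1+2[1+2n] = solve-∀

4[1+n]∸1≡4n+3 : ∀ n → 4 * suc n ∸ 1 ≡ 4 * n + 3
4[1+n]∸1≡4n+3 n = suc-injective (eq n)
  where
  eq : ∀ n → suc n + 3 * suc n ≡ suc (4 * n + 3)
  eq = solve-∀

2m≢4n+1 : ∀ m n → 2 * m ≢ 4 * n + 1
2m≢4n+1 m n eq = even≢odd m (2 * n) (trans eq (4n+1≡1+2[2n] n))

2m≢4n+3 : ∀ m n → 2 * m ≢ 4 * n + 3
2m≢4n+3 m n eq = even≢odd m (suc (2 * n)) (trans eq (4n+3≡1+2[1+2n] n))

4m+1≢4n+3 : ∀ m n → 4 * m + 1 ≢ 4 * n + 3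
4m+1≢4n+3 m n eq = even≢odd m n (*-cancelˡ-≡ _ _ 2 (suc-injective
  (trans (sym (4n+1≡1+2[2n] m)) (trans eq (4n+3≡1+2[1+2n] n)))))

4m+r-injective : ∀ m n r → 4 * m + r ≡ 4 * n + r → m ≡ n
4m+r-injective m n r eq = *-cancelˡ-≡ m n 4 (+-cancelʳ-≡ r (4 * m) (4 * n) eq)

data Mod4View : ℕ → Set where
  2t   : ∀ t → Mod4View (2 * t)
  4q+1 : ∀ q → Mod4View (4 * q + 1)
  4q+3 : ∀ q → Mod4View (4 * q + 3)

mod4View : ∀ n → Mod4View n
mod4View 0 = 2t 0
mod4View 1 = 4q+1 0
mod4View 2 = 2t 1
mod4View 3 = 4q+3 0
mod4View (suc (suc (suc (suc n)))) with mod4View n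
... | 2t t   = subst Mod4View (eq₀ t) (2t (2 + t))
  where
  eq₀ : ∀ t → 2 * (2 + t) ≡ 4 + 2 * t
  eq₀ = solve-∀
... | 4q+1 q = subst Mod4View (eq₁ q) (4q+1 (suc q))
  where
  eq₁ : ∀ q → 4 * suc q + 1 ≡ 4 + (4 * q + 1)
  eq₁ = solve-∀
... | 4q+3 q = subst Mod4View (eq₃ q) (4q+3 (suc q))
  where
  eq₃ : ∀ q → 4 * suc q + 3 ≡ 4 + (4 * q + 3)
  eq₃ = solve-∀

-- The function H

HVal-pos : ∀ {n k} → HVal n k → 1 ≤ n
HVal-pos H1      = s≤s z≤n
HVal-pos (H2n _) = s≤s z≤n
HVal-pos (H4p _) = s≤s z≤n
HVal-pos (H4m {n} _) =
  subst (1 ≤_) (sym (4[1+n]∸1≡4n+3 n)) (≤-trans (s≤s z≤n) (m≤n+m 3 (4 * n)))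

HVal-2m : ∀ {m k} → HVal m k → HVal (2 * m) k
HVal-2m {zero}  h with () ← HVal-pos h
HVal-2m {suc m} h = H2n h

HVal-4m+1 : ∀ {m k} → HVal m k → HVal (4 * m + 1) (suc k)
HVal-4m+1 {zero}  h with () ← HVal-pos h
HVal-4m+1 {suc m} h = H4p h

HVal-4m+3 : ∀ {m k} → HVal (suc m) k → HVal (4 * m + 3) (suc k)
HVal-4m+3 {m} {k} h = subst (λ n → HVal n (suc k)) (4[1+n]∸1≡4n+3 m) (H4m h)

HVal-1⁻¹ : ∀ {k} → HVal 1 k → k ≡ 0
HVal-1⁻¹ h = go h refl
  where
  go : ∀ {n k} → HVal n k → n ≡ 1 → k ≡ 0
  go H1          _  = refl
  go (H2n {n} _) eq = ⊥-elim (2m≢4n+1 (suc n) 0 eq)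
  go (H4p {n} _) eq with () ← 4m+r-injective (suc n) 0 1 eq
  go (H4m {n} _) eq = ⊥-elim (4m+1≢4n+3 0 n (trans (sym eq) (4[1+n]∸1≡4n+3 n)))

HVal-2m⁻¹ : ∀ {m k} → HVal (2 * m) k → HVal m k
HVal-2m⁻¹ {m} h = go h refl
  where
  go : ∀ {n k} → HVal n k → n ≡ 2 * m → HVal m k
  go H1                  eq = ⊥-elim (even≢odd m 0 (sym eq))
  go (H2n {n} {k} h)     eq = subst (λ n → HVal n k) (*-cancelˡ-≡ (suc n) m 2 eq) h
  go (H4p {n} _)         eq = ⊥-elim (2m≢4n+1 m (suc n) (sym eq))
  go (H4m {n} _)         eq = ⊥-elim (2m≢4n+3 m n (trans (sym eq) (4[1+n]∸1≡4n+3 n)))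

HVal-4m+1⁻¹ : ∀ {m k} → 1 ≤ m → HVal (4 * m + 1) k → ∃[ k′ ] k ≡ suc k′ × HVal m k′
HVal-4m+1⁻¹ {m} 1≤m h = go h refl
  where
  go : ∀ {n k} → HVal n k → n ≡ 4 * m + 1 → ∃[ k′ ] k ≡ suc k′ × HVal m k′
  go H1              eq = contradiction (sym (4m+r-injective 0 m 1 eq)) (n>0⇒n≢0 1≤m)
  go (H2n {n} _)     eq = ⊥-elim (2m≢4n+1 (suc n) m eq)
  go (H4p {n} {k} h) eq = k , refl , subst (λ n → HVal n k) (4m+r-injective (suc n) m 1 eq) h
  go (H4m {n} _)     eq = ⊥-elim (4m+1≢4n+3 m n (trans (sym eq) (4[1+n]∸1≡4n+3 n)))

HVal-4m+3⁻¹ : ∀ {m k} → HVal (4 * m + 3) k → ∃[ k′ ] k ≡ suc k′ × HVal (suc m) k′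
HVal-4m+3⁻¹ {m} h = go h refl
  where
  go : ∀ {n k} → HVal n k → n ≡ 4 * m + 3 → ∃[ k′ ] k ≡ suc k′ × HVal (suc m) k′
  go H1              eq = ⊥-elim (4m+1≢4n+3 0 m eq)
  go (H2n {n} _)     eq = ⊥-elim (2m≢4n+3 (suc n) m eq)
  go (H4p {n} _)     eq = ⊥-elim (4m+1≢4n+3 (suc n) m eq)
  go (H4m {n} {k} h) eq = k , refl ,
    subst (λ n → HVal (suc n) k) (4m+r-injective n m 3 (trans (sym (4[1+n]∸1≡4n+3 n)) eq)) h

HVal-functional : ∀ {n k k′} → HVal n k → HVal n k′ → k ≡ k′
HVal-functional H1      h′ = sym (HVal-1⁻¹ h′)
HVal-functional (H2n {n} h) h′ = HVal-functional h (HVal-2m⁻¹ {suc n} h′)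
HVal-functional (H4p {n} h) h′ with HVal-4m+1⁻¹ {suc n} (s≤s z≤n) h′
... | _ , refl , h″ = cong suc (HVal-functional h h″)
HVal-functional {k′ = k′} (H4m {n} h) h′
  with HVal-4m+3⁻¹ {n} (subst (λ m → HVal m k′) (4[1+n]∸1≡4n+3 n) h′)
... | _ , refl , h″ = cong suc (HVal-functional h h″)

Raises : ℕ → ℕ → Set
Raises m n = ∀ {k} → HVal m k → HVal n (suc k)

Raises-values : ∀ {m n k} → HVal m k → HVal n (suc k) → Raises m n
Raises-values {n = n} hm hn h = subst (λ k → HVal n (suc k)) (HVal-functional hm h) hn

Raises-2m : ∀ {m n} → Raises m n → Raises (2 * m) (2 * n)
Raises-2m {m} r h = HVal-2m (r (HVal-2m⁻¹ {m} h))

Raises-4m+1 : ∀ {m n} → 1 ≤ m → Raises m n → Raises (4 * m + 1) (4 * n + 1)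
Raises-4m+1 {m} 1≤m r h with HVal-4m+1⁻¹ {m} 1≤m h
... | _ , refl , h′ = HVal-4m+1 (r h′)

Raises-4m+3 : ∀ {m n} → Raises (suc m) (suc n) → Raises (4 * m + 3) (4 * n + 3)
Raises-4m+3 {m} {n} r h with HVal-4m+3⁻¹ {m} h
... | _ , refl , h′ = HVal-4m+3 {n} (r h′)

1≤Q*2^j+t : ∀ {Q} j t → 1 ≤ Q → 1 ≤ Q * 2 ^ j + t
1≤Q*2^j+t {Q} j t 1≤Q = ≤-trans (*-mono-≤ 1≤Q (m^n>0 2 j)) (m≤m+n (Q * 2 ^ j) t)

2[QN+t]≡Q[2N]+2t : ∀ Q N t → 2 * (Q * N + t) ≡ Q * (2 * N) + 2 * t
2[QN+t]≡Q[2N]+2t = solve-∀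

4[QN+q]+r≡Q[4N]+[4q+r] : ∀ Q N q r → 4 * (Q * N + q) + r ≡ Q * (2 * (2 * N)) + (4 * q + r)
4[QN+q]+r≡Q[4N]+[4q+r] = solve-∀

4q+1+r≤4N⇒q<N : ∀ q r N → 4 * q + suc r ≤ 2 * (2 * N) → q < N
4q+1+r≤4N⇒q<N q r N le = *-cancelˡ-< 4 q N (begin-strict
  4 * q             <⟨ m<m+n (4 * q) (s≤s z≤n) ⟩
  4 * q + suc r     ≤⟨ le ⟩
  2 * (2 * N)       ≡⟨ eq N ⟩
  4 * N             ∎)
  where
  open ≤-Reasoning
  eq : ∀ N → 2 * (2 * N) ≡ 4 * N
  eq = solve-∀

module _ {P′ P : ℕ} (1≤P′ : 1 ≤ P′) (1≤P : 1 ≤ P)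
         (raise₀ : Raises P′ P) (raise₁ : Raises (P′ + 1) (P + 1))
         (raise₂ : Raises (2 * P′ + 1) (2 * P + 1)) where

  Shifted : ℕ → Set
  Shifted j = ∀ T → T ≤ 2 ^ j → Raises (P′ * 2 ^ j + T) (P * 2 ^ j + T)

  Shifted-even : ∀ j → Shifted j → ∀ t → 2 * t ≤ 2 ^ suc j →
                 Raises (P′ * 2 ^ suc j + 2 * t) (P * 2 ^ suc j + 2 * t)
  Shifted-even j shifted t le =
    subst₂ Raises (2[QN+t]≡Q[2N]+2t P′ (2 ^ j) t) (2[QN+t]≡Q[2N]+2t P (2 ^ j) t)
      (Raises-2m (shifted t (*-cancelˡ-≤ 2 le)))

  Shifted-0 : Shifted 0
  Shifted-0 0 _ = subst₂ Raises (Q≡Q*1+0 P′) (Q≡Q*1+0 P) raise₀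
    where
    Q≡Q*1+0 : ∀ Q → Q ≡ Q * 1 + 0
    Q≡Q*1+0 Q = sym (trans (+-identityʳ (Q * 1)) (*-identityʳ Q))
  Shifted-0 1 _ =
    subst₂ Raises (cong (_+ 1) (sym (*-identityʳ P′))) (cong (_+ 1) (sym (*-identityʳ P))) raise₁
  Shifted-0 (suc (suc _)) (s≤s ())

  Shifted-1 : Shifted 1
  Shifted-1 0 le = Shifted-even 0 Shifted-0 0 le
  Shifted-1 1 _  = subst₂ Raises (cong (_+ 1) (*-comm 2 P′)) (cong (_+ 1) (*-comm 2 P)) raise₂
  Shifted-1 2 le = Shifted-even 0 Shifted-0 1 le
  Shifted-1 (suc (suc (suc _))) (s≤s (s≤s ()))

  Shifted-step : ∀ j → Shifted j → Shifted (suc j) → Shifted (suc (suc j))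
  Shifted-step j shifted shifted′ T le with mod4View T
  ... | 2t t   = Shifted-even (suc j) shifted′ t le
  ... | 4q+1 q = subst₂ Raises (4[QN+q]+r≡Q[4N]+[4q+r] P′ (2 ^ j) q 1) (4[QN+q]+r≡Q[4N]+[4q+r] P (2 ^ j) q 1)
    (Raises-4m+1 (1≤Q*2^j+t j q 1≤P′) (shifted q (<⇒≤ (4q+1+r≤4N⇒q<N q 0 (2 ^ j) le))))
  ... | 4q+3 q = subst₂ Raises (4[QN+q]+r≡Q[4N]+[4q+r] P′ (2 ^ j) q 3) (4[QN+q]+r≡Q[4N]+[4q+r] P (2 ^ j) q 3)
    (Raises-4m+3 (subst₂ Raises (+-suc (P′ * 2 ^ j) q) (+-suc (P * 2 ^ j) q)
      (shifted (suc q) (4q+1+r≤4N⇒q<N q 2 (2 ^ j) le))))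

  Raises-shifted : ∀ j → Shifted j
  Raises-shifted 0             = Shifted-0
  Raises-shifted 1             = Shifted-1
  Raises-shifted (suc (suc j)) = Shifted-step j (Raises-shifted j) (Raises-shifted (suc j))

-- Binary values of words

pushDigit : ℕ → Letter → ℕ
pushDigit acc c = 2 * acc + digit c

foldl-pushDigit : ∀ s acc → foldl pushDigit acc s ≡ acc * 2 ^ length s + ⟨ s ⟩
foldl-pushDigit []      acc = sym (trans (+-identityʳ (acc * 1)) (*-identityʳ acc))
foldl-pushDigit (c ∷ s) acc = begin
  foldl pushDigit (2 * acc + digit c) s            ≡⟨ foldl-pushDigit s (2 * acc + digit c) ⟩
  (2 * acc + digit c) * N + ⟨ s ⟩                  ≡⟨ eq acc (digit c) N ⟨ s ⟩ ⟩
  acc * (2 * N) + (digit c * N + ⟨ s ⟩)            ≡⟨ cong (acc * (2 * N) +_) (sym (foldl-pushDigit s (digit c))) ⟩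
  acc * (2 * N) + ⟨ c ∷ s ⟩                        ∎
  where
  open ≡-Reasoning
  N = 2 ^ length s
  eq : ∀ x d N X → (2 * x + d) * N + X ≡ x * (2 * N) + (d * N + X)
  eq = solve-∀

⟨⟩-++ : ∀ u s → ⟨ u ++ s ⟩ ≡ ⟨ u ⟩ * 2 ^ length s + ⟨ s ⟩
⟨⟩-++ u s = trans (foldl-++ pushDigit 0 u s) (foldl-pushDigit s ⟨ u ⟩)

⟨⟩-∷ʳ : ∀ u c → ⟨ u ++ c ∷ [] ⟩ ≡ 2 * ⟨ u ⟩ + digit c
⟨⟩-∷ʳ u c = foldl-++ pushDigit 0 u (c ∷ [])

⟨⟩<2^length : ∀ s → ⟨ s ⟩ < 2 ^ length s
⟨⟩<2^length []      = s≤s z≤n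
⟨⟩<2^length (c ∷ s) = begin-strict
  ⟨ c ∷ s ⟩               ≡⟨ ⟨⟩-++ (c ∷ []) s ⟩
  digit c * N + ⟨ s ⟩     <⟨ +-monoʳ-< (digit c * N) (⟨⟩<2^length s) ⟩
  digit c * N + N         ≡⟨ +-comm (digit c * N) N ⟩
  suc (digit c) * N       ≤⟨ *-monoˡ-≤ N (digit<2 c) ⟩
  2 * N                   ∎
  where
  open ≤-Reasoning
  N = 2 ^ length s
  digit<2 : ∀ c → digit c < 2
  digit<2 a = s≤s z≤n
  digit<2 b = s≤s (s≤s z≤n)

replicate-∷ʳ : ∀ n (x : Letter) → replicate n x ++ x ∷ [] ≡ x ∷ replicate n x
replicate-∷ʳ zero    x = refl
replicate-∷ʳ (suc n) x = cong (x ∷_) (replicate-∷ʳ n x)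

⟨bⁿ⁺¹⟩ : ∀ n → ⟨ replicate (suc n) b ⟩ ≡ 2 * ⟨ replicate n b ⟩ + 1
⟨bⁿ⁺¹⟩ n = trans (cong ⟨_⟩ (sym (replicate-∷ʳ n b))) (⟨⟩-∷ʳ (replicate n b) b)

1+⟨bⁿ⟩≡2^n : ∀ n → suc ⟨ replicate n b ⟩ ≡ 2 ^ n
1+⟨bⁿ⟩≡2^n zero    = refl
1+⟨bⁿ⟩≡2^n (suc n) = begin
  suc ⟨ replicate (suc n) b ⟩      ≡⟨ cong suc (⟨bⁿ⁺¹⟩ n) ⟩
  suc (2 * ⟨ replicate n b ⟩ + 1)  ≡⟨ eq ⟨ replicate n b ⟩ ⟩
  2 * suc ⟨ replicate n b ⟩        ≡⟨ cong (2 *_) (1+⟨bⁿ⟩≡2^n n) ⟩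
  2 * 2 ^ n                        ∎
  where
  open ≡-Reasoning
  eq : ∀ M → suc (2 * M + 1) ≡ 2 * suc M
  eq = solve-∀

⟨baⁿ⟩≡2^n : ∀ n → ⟨ b ∷ replicate n a ⟩ ≡ 2 ^ n
⟨baⁿ⟩≡2^n zero    = refl
⟨baⁿ⟩≡2^n (suc n) = begin
  ⟨ b ∷ replicate (suc n) a ⟩      ≡⟨ cong (λ w → ⟨ b ∷ w ⟩) (sym (replicate-∷ʳ n a)) ⟩
  ⟨ b ∷ replicate n a ++ a ∷ [] ⟩  ≡⟨ ⟨⟩-∷ʳ (b ∷ replicate n a) a ⟩
  2 * ⟨ b ∷ replicate n a ⟩ + 0    ≡⟨ +-identityʳ _ ⟩
  2 * ⟨ b ∷ replicate n a ⟩        ≡⟨ cong (2 *_) (⟨baⁿ⟩≡2^n n) ⟩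
  2 * 2 ^ n                        ∎
  where open ≡-Reasoning

HVal-2^n : ∀ n → HVal (2 ^ n) 0
HVal-2^n zero    = H1
HVal-2^n (suc n) = HVal-2m (HVal-2^n n)

HVal-2^[1+n]+1 : ∀ n → HVal (2 ^ suc n + 1) 1
HVal-2^[1+n]+1 zero    = H4m H1
HVal-2^[1+n]+1 (suc n) = subst (λ m → HVal m 1) (eq (2 ^ n)) (HVal-4m+1 (HVal-2^n n))
  where
  eq : ∀ N → 4 * N + 1 ≡ 2 * (2 * N) + 1
  eq = solve-∀

HVal-⟨bⁿ⁺²⟩ : ∀ n → HVal ⟨ replicate (2 + n) b ⟩ 1
HVal-⟨bⁿ⁺²⟩ n = subst (λ m → HVal m 1) (sym ⟨bⁿ⁺²⟩≡4M+3)
  (HVal-4m+3 (subst (λ m → HVal m 0) (sym (1+⟨bⁿ⟩≡2^n n)) (HVal-2^n n)))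
  where
  M = ⟨ replicate n b ⟩
  eq : ∀ M → 2 * (2 * M + 1) + 1 ≡ 4 * M + 3
  eq = solve-∀
  ⟨bⁿ⁺²⟩≡4M+3 : ⟨ replicate (2 + n) b ⟩ ≡ 4 * M + 3
  ⟨bⁿ⁺²⟩≡4M+3 = trans (⟨bⁿ⁺¹⟩ (suc n)) (trans (cong (λ m → 2 * m + 1) (⟨bⁿ⁺¹⟩ n)) (eq M))

SwitchValues : ℕ → Set
SwitchValues P = HVal P 1 × HVal (P + 1) 1 × HVal (2 * P + 1) 2

SwitchValues-2^[2+n]+1 : ∀ n → SwitchValues (2 ^ suc (suc n) + 1)
SwitchValues-2^[2+n]+1 n =
  HVal-2^[1+n]+1 (suc n) ,
  subst (λ m → HVal m 1) (eq₁ N) (HVal-2m (HVal-2^[1+n]+1 n)) ,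
  subst (λ m → HVal m 2) (eq₂ N) (HVal-4m+3 (subst (λ m → HVal m 1) (+-comm N 1) (HVal-2^[1+n]+1 n)))
  where
  N = 2 ^ suc n
  eq₁ : ∀ N → 2 * (N + 1) ≡ 2 * N + 1 + 1
  eq₁ = solve-∀
  eq₂ : ∀ N → 4 * N + 3 ≡ 2 * (2 * N + 1) + 1
  eq₂ = solve-∀

SwitchValues-2⟨bⁿ⁺²⟩ : ∀ n → SwitchValues (2 * ⟨ replicate (2 + n) b ⟩)
SwitchValues-2⟨bⁿ⁺²⟩ n =
  HVal-2m (HVal-⟨bⁿ⁺²⟩ n) ,
  subst (λ m → HVal m 1) (⟨bⁿ⁺¹⟩ (2 + n)) (HVal-⟨bⁿ⁺²⟩ (suc n)) ,
  subst (λ m → HVal m 2) (eq ⟨ replicate (2 + n) b ⟩) (HVal-4m+1 (HVal-⟨bⁿ⁺²⟩ n))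
  where
  eq : ∀ U → 4 * U + 1 ≡ 2 * (2 * U) + 1
  eq = solve-∀

Raises-insert : ∀ w → SwitchValues ⟨ b ∷ w ⟩ → ∀ s → Raises ⟨ b ∷ s ⟩ ⟨ b ∷ w ++ s ⟩
Raises-insert w (h₀ , h₁ , h₂) s =
  subst₂ Raises (sym (⟨⟩-++ (b ∷ []) s)) (sym (⟨⟩-++ (b ∷ w) s))
    (Raises-shifted (s≤s z≤n) (HVal-pos h₀)
      (Raises-values H1 h₀) (Raises-values (H2n H1) h₁) (Raises-values (H4m H1) h₂)
      (length s) ⟨ s ⟩ (<⇒≤ (⟨⟩<2^length s)))

-- Runs

opposite : Letter → Letter
opposite a = b
opposite b = a

opposite-≢ : ∀ x → opposite x ≢ x
opposite-≢ a ()
opposite-≢ b ()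

data Runs : Word → Set where
  ε      : Runs []
  run    : ∀ x i → Runs (x ∷ replicate i x)
  switch : ∀ x i {r} → Runs r → Runs (x ∷ replicate i x ++ opposite x ∷ r)

extend : ∀ {x v} → Runs (x ∷ v) → Runs (x ∷ x ∷ v)
extend (run x i)       = run x (suc i)
extend (switch x i rs) = switch x (suc i) rs

runs : ∀ v → Runs v
runs []           = ε
runs (x ∷ [])     = run x 0
runs (a ∷ a ∷ v)  = extend (runs (a ∷ v))
runs (a ∷ b ∷ v)  = switch a 0 (runs v)
runs (b ∷ b ∷ v)  = extend (runs (b ∷ v))
runs (b ∷ a ∷ v)  = switch b 0 (runs v)

switch-nonconstant : ∀ x i r → ¬ Constant (x ∷ replicate i x ++ opposite x ∷ r)
switch-nonconstant x i r (z , x≡z ∷ rest) with ++⁻ʳ (replicate i x) rest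
... | x̄≡z ∷ _ = opposite-≢ x (trans x̄≡z (sym x≡z))

₊-switch : ∀ x i r → ₊ (x ∷ replicate i x ++ opposite x ∷ r) ≡ r
₊-switch a zero    r = refl
₊-switch a (suc i) r = ₊-switch a i r
₊-switch b zero    r = refl
₊-switch b (suc i) r = ₊-switch b i r

switch-values : ∀ x i → SwitchValues ⟨ b ∷ x ∷ replicate i x ++ opposite x ∷ [] ⟩
switch-values a i = subst SwitchValues (sym ⟨bai+1b⟩) (SwitchValues-2^[2+n]+1 i)
  where
  ⟨bai+1b⟩ : ⟨ b ∷ a ∷ replicate i a ++ b ∷ [] ⟩ ≡ 2 ^ suc (suc i) + 1
  ⟨bai+1b⟩ = trans (⟨⟩-∷ʳ (b ∷ a ∷ replicate i a) b) (cong (λ U → 2 * U + 1) (⟨baⁿ⟩≡2^n (suc i)))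
switch-values b i = subst SwitchValues (sym ⟨bbi+1a⟩) (SwitchValues-2⟨bⁿ⁺²⟩ i)
  where
  ⟨bbi+1a⟩ : ⟨ b ∷ b ∷ replicate i b ++ a ∷ [] ⟩ ≡ 2 * ⟨ replicate (2 + i) b ⟩
  ⟨bbi+1a⟩ = trans (⟨⟩-∷ʳ (b ∷ b ∷ replicate i b) a) (+-identityʳ _)

HVal-run : ∀ x i → HVal ⟨ b ∷ (x ∷ replicate i x) ++ b ∷ [] ⟩ 1
HVal-run a i = proj₁ (switch-values a i)
HVal-run b i =
  subst (λ w → HVal ⟨ b ∷ b ∷ w ⟩ 1) (sym (replicate-∷ʳ i b)) (HVal-⟨bⁿ⁺²⟩ (suc i))

HVal-switch : ∀ x i r {k} → HVal ⟨ b ∷ r ++ b ∷ [] ⟩ k →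
              HVal ⟨ b ∷ (x ∷ replicate i x ++ opposite x ∷ r) ++ b ∷ [] ⟩ (suc k)
HVal-switch x i r h =
  subst (λ w → HVal ⟨ b ∷ x ∷ w ⟩ _) regroup
    (Raises-insert (x ∷ replicate i x ++ opposite x ∷ []) (switch-values x i) (r ++ b ∷ []) h)
  where
  xs = replicate i x
  regroup : (xs ++ opposite x ∷ []) ++ r ++ b ∷ [] ≡ (xs ++ opposite x ∷ r) ++ b ∷ []
  regroup = trans (++-assoc xs (opposite x ∷ []) (r ++ b ∷ []))
                  (sym (++-assoc xs (opposite x ∷ r) (b ∷ [])))

height-H : ∀ {v} → Runs v → Σ ℕ λ k → Height v k × HVal ⟨ b ∷ (v ++ b ∷ []) ⟩ k
height-H ε         = 1 , const (a , []) , H4m H1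
height-H (run x i) = 1 , const (x , refl ∷ replicate⁺ i refl) , HVal-run x i
height-H (switch x i {r} rs) with height-H rs
... | k , height , hval =
  suc k ,
  step (switch-nonconstant x i r) (subst (λ w → Height w k) (sym (₊-switch x i r)) height) ,
  HVal-switch x i r hval

mainTheorem14 : (v : Word) → Σ ℕ λ k → Height v k × HVal ⟨ b ∷ (v ++ b ∷ []) ⟩ k
mainTheorem14 v = height-H (runs v)
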